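{- $\chi_\mu(K_n\,\square\, K_n)=\Theta(\sqrt{n})$ as $n\to\infty$; that is, there exist constants $c_1,c_2>0$ and $N$ such that $c_1\sqrt{n}\le \chi_\mu(K_n\,\square\, K_n)\le c_2\sqrt{n}$ for all $n\ge N$.
   Context: $K_n\,\square\, K_n$ is the Cartesian product of two complete graphs on $n$ vertices: vertex set $V(K_n)\times V(K_n)$, with $(g,h)$ adjacent to $(g',h')$ iff either $g=g'$ and $h\ne h'$, or $h=h'$ and $g\neq g'$. For a connected graph $G$ and $S\subseteq V(G)$, two vertices $x,y\in S$ are $S$-visible if there is a shortest $x,y$-path $P$ in $G$ with $V(P)\cap S=\{x,y\}$. $S$ is a mutual-visibility set if any two vertices of $S$ are $S$-visible. A mutual-visibility coloring of $G$ is a partition of $V(G)$ into mutual-visibility sets, and the mutual-visibility chromatic number $\chi_\mu(G)$ is the smallest number of classes in such a partition. -}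

module Defs where

open import Data.Nat using (ℕ; zero; suc; _≤_; _<_)
open import Data.Fin using (Fin)
open import Data.Product using (Σ; _×_; _,_)
open import Data.Sum using (_⊎_)
open import Data.List using (List; []; _∷_)
open import Data.List.Relation.Unary.All using (All)
open import Relation.Binary.PropositionalEquality using (_≡_; _≢_)
open import Relation.Nullary using (¬_)

record Graph : Set₁ where
  field
    V   : Set
    Adj : V → V → Set
open Graph public

module _ (G : Graph) where

  data Walk : V G → V G → Set where
    []  : ∀ {x} → Walk x x
    _∷_ : ∀ {x y z} → Adj G x y → Walk y z → Walk x z

  len : ∀ {x y} → Walk x y → ℕ
  len []      = zero
  len (_ ∷ w) = suc (len w)

  verts : ∀ {x y} → Walk x y → List (V G)
  verts {x} []      = x ∷ []
  verts {x} (_ ∷ w) = x ∷ verts w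

  Shortest : ∀ {x y} → Walk x y → Set
  Shortest {x} {y} P = (Q : Walk x y) → len P ≤ len Q

  Visible : (S : V G → Set) → V G → V G → Set
  Visible S x y =
    Σ (Walk x y) λ P → Shortest P ×
      All (λ v → S v → (v ≡ x) ⊎ (v ≡ y)) (verts P)

  MutualVisibility : (V G → Set) → Set
  MutualVisibility S = ∀ x y → S x → S y → Visible S x y

  -- a mutual-visibility coloring with k colors: every colour class is a
  -- mutual-visibility set (empty classes allowed; irrelevant for the minimum)
  MVColoring : ℕ → Set
  MVColoring k =
    Σ (V G → Fin k) λ c → (i : Fin k) → MutualVisibility (λ v → c v ≡ i)

  IsChiMu : ℕ → Set
  IsChiMu k = MVColoring k × ((m : ℕ) → m < k → ¬ MVColoring m)

KnKn : ℕ → Graph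
KnKn n = record
  { V   = Fin n × Fin n
  ; Adj = λ { (g , h) (g' , h') →
              ((g ≡ g') × (h ≢ h')) ⊎ ((h ≡ h') × (g ≢ g')) } }

module Submission where

-- In K_n □ K_n two vertices of a colour class S in different rows and columns are
-- S-visible iff one of the two other corners of their rectangle lies outside S, since a
-- shortest path between them has length 2 and turns at such a corner. So mutual-visibility
-- colourings are the colourings of the n × n grid without a monochromatic rectangle.
--
-- Lower bound: by Cauchy–Schwarz a row with k colours has at least n²/k ordered pairs of
-- equally coloured cells, whereas two distinct columns agree in at most one row per colour.
-- Counting the triples (row, column, column) both ways gives n ≤ k (k + 1).
--
-- Upper bound: for a prime p with n ≤ p², index rows by lines y = s x + t and columns by
-- points (x , y) of 𝔽ₚ², and colour a cell by y − s x − t. Lines of distinct slopes meet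
-- once, so no rectangle is monochromatic and χ_μ ≤ p. Such a p with p² ≤ 400 n exists for
-- large n by Erdős' argument: lcm(1, …, 4x + 1) ≥ 4²ˣ (Leibniz's harmonic triangle) and
-- ∏_{p ≤ y} p ≤ 4ʸ force a prime into (x , 4x + 1] once x is large.

module Visibility where

  open import Defs
  open import Data.Nat using (ℕ; _≤_; z≤n; s≤s)
  open import Data.Fin using (Fin)
  open import Data.Fin.Properties using (_≟_)
  open import Data.Product using (Σ; _,_; proj₁; proj₂; curry)
  open import Data.Sum using (_⊎_; inj₁; inj₂)
  open import Data.List.Relation.Unary.All using (All; []; _∷_)
  open import Data.Empty using (⊥; ⊥-elim)
  open import Relation.Nullary using (¬_; yes; no; contradiction)
  open import Relation.Binary.PropositionalEquality
  open import Function using (_∘_; _⇔_; mk⇔)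
  open import Function.Definitions using (Injective)

  module _ (G : Graph) where

    []-shortest : ∀ {x} → Shortest G ([] {x = x})
    []-shortest _ = z≤n

    edge-shortest : ∀ {x y} (e : Adj G x y) → x ≢ y → Shortest G (e ∷ [])
    edge-shortest e x≢y []      = contradiction refl x≢y
    edge-shortest e x≢y (_ ∷ _) = s≤s z≤n

    path₂-shortest : ∀ {x y z} (e : Adj G x y) (e′ : Adj G y z) →
                     x ≢ z → ¬ Adj G x z → Shortest G (e ∷ e′ ∷ [])
    path₂-shortest e e′ x≢z ¬adj []              = contradiction refl x≢z
    path₂-shortest e e′ x≢z ¬adj (f ∷ [])        = contradiction f ¬adj
    path₂-shortest e e′ x≢z ¬adj (_ ∷ _ ∷ _)     = s≤s (s≤s z≤n)

  RectangleFree : {R C K : Set} → (R → C → K) → Set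
  RectangleFree c = ∀ {a a′ b b′ i} → a ≢ a′ → b ≢ b′ →
    c a b ≡ i → c a b′ ≡ i → c a′ b ≡ i → c a′ b′ ≡ i → ⊥

  rectangleFree-∘ : ∀ {R C R′ C′ K : Set} (c : R → C → K) {f : R′ → R} {g : C′ → C} →
                    Injective _≡_ _≡_ f → Injective _≡_ _≡_ g →
                    RectangleFree c → RectangleFree (λ a b → c (f a) (g b))
  rectangleFree-∘ c f-inj g-inj rf a≢a′ b≢b′ = rf (a≢a′ ∘ f-inj) (b≢b′ ∘ g-inj)

  module _ {n : ℕ} where

    private
      G = KnKn n

    along-row : ∀ {a b b′} → b ≢ b′ → Adj G (a , b) (a , b′)
    along-row b≢b′ = inj₁ (refl , b≢b′)

    along-column : ∀ {a a′ b} → a ≢ a′ → Adj G (a , b) (a′ , b)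
    along-column a≢a′ = inj₂ (refl , a≢a′)

    ¬adjacent : ∀ {a a′ b b′} → a ≢ a′ → b ≢ b′ → ¬ Adj G (a , b) (a′ , b′)
    ¬adjacent a≢a′ b≢b′ (inj₁ (a≡a′ , _)) = a≢a′ a≡a′
    ¬adjacent a≢a′ b≢b′ (inj₂ (b≡b′ , _)) = b≢b′ b≡b′

    -- A walk of length ≤ 2 between opposite corners of a rectangle turns at one of
    -- the other two corners.
    opposite-corners-invisible :
      ∀ (S : V G → Set) {a a′ b b′} → a ≢ a′ → b ≢ b′ → S (a , b′) → S (a′ , b) →
      ¬ Visible G S (a , b) (a′ , b′)
    opposite-corners-invisible S {a} {a′} {b} {b′} a≢a′ b≢b′ s₁ s₂ (P , P-short , P-avoids) =
      go P (P-short (along-row b≢b′ ∷ along-column a≢a′ ∷ [])) P-avoids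
      where
      go : (P : Walk G (a , b) (a′ , b′)) → len G P ≤ 2 →
           All (λ v → S v → (v ≡ (a , b)) ⊎ (v ≡ (a′ , b′))) (verts G P) → ⊥
      go [] _ _ = a≢a′ refl
      go (inj₁ (refl , _) ∷ []) _ _ = a≢a′ refl
      go (inj₂ (refl , _) ∷ []) _ _ = b≢b′ refl
      go (inj₁ (refl , _) ∷ inj₁ (refl , _) ∷ []) _ _ = a≢a′ refl
      go (inj₂ (refl , _) ∷ inj₂ (refl , _) ∷ []) _ _ = b≢b′ refl
      go (inj₁ (refl , b≢v) ∷ inj₂ (refl , _) ∷ []) _ (_ ∷ avoids ∷ _) with avoids s₁
      ... | inj₁ refl = b≢v refl
      ... | inj₂ refl = a≢a′ refl
      go (inj₂ (refl , a≢u) ∷ inj₁ (refl , _) ∷ []) _ (_ ∷ avoids ∷ _) with avoids s₂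
      ... | inj₁ refl = a≢u refl
      ... | inj₂ refl = b≢b′ refl
      go (_ ∷ _ ∷ _ ∷ _) (s≤s (s≤s ())) _

    mutualVisibility⇒rectangleFree : ∀ {k} (c : V G → Fin k) →
      (∀ i → MutualVisibility G (λ v → c v ≡ i)) → RectangleFree (curry c)
    mutualVisibility⇒rectangleFree c mv a≢a′ b≢b′ c₁ c₂ c₃ c₄ =
      opposite-corners-invisible _ a≢a′ b≢b′ c₂ c₃ (mv _ _ _ c₁ c₄)

    rectangleFree⇒mutualVisibility : ∀ {k} (c : V G → Fin k) →
      RectangleFree (curry c) → ∀ i → MutualVisibility G (λ v → c v ≡ i)
    rectangleFree⇒mutualVisibility c rf i (a , b) (a′ , b′) cx cy with a ≟ a′ | b ≟ b′
    ... | yes refl | yes refl = [] , []-shortest G , (λ _ → inj₁ refl) ∷ []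
    ... | yes refl | no b≢b′ =
      along-row b≢b′ ∷ [] , edge-shortest G (along-row b≢b′) (b≢b′ ∘ cong proj₂) ,
      (λ _ → inj₁ refl) ∷ (λ _ → inj₂ refl) ∷ []
    ... | no a≢a′ | yes refl =
      along-column a≢a′ ∷ [] , edge-shortest G (along-column a≢a′) (a≢a′ ∘ cong proj₁) ,
      (λ _ → inj₁ refl) ∷ (λ _ → inj₂ refl) ∷ []
    ... | no a≢a′ | no b≢b′ with c (a , b′) ≟ i
    ...   | no c₂≢i =
      along-row b≢b′ ∷ along-column a≢a′ ∷ [] ,
      path₂-shortest G (along-row b≢b′) (along-column a≢a′) (a≢a′ ∘ cong proj₁) (¬adjacent a≢a′ b≢b′) ,
      (λ _ → inj₁ refl) ∷ (λ c₂ → contradiction c₂ c₂≢i) ∷ (λ _ → inj₂ refl) ∷ []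
    ...   | yes c₂ =
      along-column a≢a′ ∷ along-row b≢b′ ∷ [] ,
      path₂-shortest G (along-column a≢a′) (along-row b≢b′) (a≢a′ ∘ cong proj₁) (¬adjacent a≢a′ b≢b′) ,
      (λ _ → inj₁ refl) ∷ (λ c₃ → ⊥-elim (rf a≢a′ b≢b′ cx c₂ c₃ cy)) ∷ (λ _ → inj₂ refl) ∷ []

    mvColoring⇔rectangleFree : ∀ {k} → MVColoring G k ⇔ Σ (V G → Fin k) (RectangleFree ∘ curry)
    mvColoring⇔rectangleFree = mk⇔
      (λ (c , mv) → c , mutualVisibility⇒rectangleFree c mv)
      (λ (c , rf) → c , rectangleFree⇒mutualVisibility c rf)

module Counting where

  open import Data.Nat using (ℕ; zero; suc; _+_; _*_; _∸_; _≤_; z≤n; s≤s)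
  open import Data.Nat.Properties hiding (_≟_)
  open import Data.Nat.Tactic.RingSolver using (solve; solve-∀)
  open import Algebra.Properties.Semiring.Sum +-*-semiring
    using (sum; sum-syntax; sum-cong-≗; ∑-comm; ∑-distrib-+; *-distribˡ-sum; *-distribʳ-sum)
  open import Data.Fin using (Fin; zero; suc)
  open import Data.Fin.Properties using (_≟_) renaming (suc-injective to fsuc-injective; 0≢1+n to 0≢fsuc)
  open import Data.Bool using (if_then_else_)
  open import Data.List using (_∷_; [])
  open import Data.Product using (_×_; _,_)
  open import Data.Sum using (inj₁; inj₂)
  open import Data.Empty using (⊥-elim)
  open import Relation.Nullary using (yes; no; does; contradiction)
  open import Relation.Binary.PropositionalEquality
  open import Function using (_∘_)
  open Visibility using (RectangleFree)

  sum-mono-≤ : ∀ {n} (f g : Fin n → ℕ) → (∀ i → f i ≤ g i) → sum f ≤ sum g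
  sum-mono-≤ {zero}  f g f≤g = z≤n
  sum-mono-≤ {suc n} f g f≤g = +-mono-≤ (f≤g zero) (sum-mono-≤ (f ∘ suc) (g ∘ suc) (f≤g ∘ suc))

  sum-const : ∀ n c → ∑[ i < n ] c ≡ n * c
  sum-const zero    c = refl
  sum-const (suc n) c = cong (c +_) (sum-const n c)

  sum-*-sum : ∀ {m n} (f : Fin m → ℕ) (g : Fin n → ℕ) →
              sum f * sum g ≡ ∑[ i < m ] ∑[ j < n ] (f i * g j)
  sum-*-sum f g = begin
    sum f * sum g                     ≡⟨ *-distribʳ-sum (sum g) f ⟩
    ∑[ i < _ ] (f i * sum g)          ≡⟨ sum-cong-≗ (λ i → *-distribˡ-sum (f i) g) ⟩
    ∑[ i < _ ] ∑[ j < _ ] (f i * g j) ∎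
    where open ≡-Reasoning

  sum-0 : ∀ n → ∑[ i < n ] 0 ≡ 0
  sum-0 n = trans (sum-const n 0) (*-zeroʳ n)

  sum≤1 : ∀ {n} (f : Fin n → ℕ) → (∀ i → f i ≤ 1) →
          (∀ i j → 1 ≤ f i → 1 ≤ f j → i ≡ j) → sum f ≤ 1
  sum≤1 {zero}  f f≤1 unique = z≤n
  sum≤1 {suc n} f f≤1 unique with f zero in eq
  ... | zero  = sum≤1 (f ∘ suc) (f≤1 ∘ suc) (λ i j fi fj → fsuc-injective (unique _ _ fi fj))
  ... | suc _ = +-mono-≤ (subst (_≤ 1) eq (f≤1 zero))
                         (≤-trans (sum-mono-≤ (f ∘ suc) (λ _ → 0) rest≤0) (≤-reflexive (sum-0 n)))
    where
    rest≤0 : ∀ i → f (suc i) ≤ 0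
    rest≤0 i = ≮⇒≥ (λ 1≤fi → 0≢fsuc (unique zero (suc i) (subst (1 ≤_) (sym eq) (s≤s z≤n)) 1≤fi))

  2x[x+d]≤x²+[x+d]² : ∀ x d → 2 * (x * (x + d)) ≤ x * x + (x + d) * (x + d)
  2x[x+d]≤x²+[x+d]² x d = ≤-trans (m≤m+n _ (d * d)) (≤-reflexive (solve (x ∷ d ∷ [])))

  2xy≤x²+y² : ∀ x y → 2 * (x * y) ≤ x * x + y * y
  2xy≤x²+y² x y with ≤-total x y
  ... | inj₁ x≤y = subst (λ y → 2 * (x * y) ≤ x * x + y * y) (m+[n∸m]≡n x≤y) (2x[x+d]≤x²+[x+d]² x (y ∸ x))
  ... | inj₂ y≤x = subst₂ _≤_ (cong (2 *_) (*-comm y x)) (+-comm (y * y) (x * x))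
    (subst (λ x → 2 * (y * x) ≤ y * y + x * x) (m+[n∸m]≡n y≤x) (2x[x+d]≤x²+[x+d]² y (x ∸ y)))

  cauchy-schwarz : ∀ {n} (x : Fin n → ℕ) → sum x * sum x ≤ n * ∑[ i < n ] (x i * x i)
  cauchy-schwarz {n} x = *-cancelˡ-≤ 2 (begin
    2 * (sum x * sum x)                          ≡⟨ cong (2 *_) (sum-*-sum x x) ⟩
    2 * ∑[ i < n ] ∑[ j < n ] (x i * x j)        ≡⟨ *-distribˡ-sum 2 (λ i → ∑[ j < n ] (x i * x j)) ⟩
    ∑[ i < n ] (2 * ∑[ j < n ] (x i * x j))      ≡⟨ sum-cong-≗ (λ i → *-distribˡ-sum 2 (λ j → x i * x j)) ⟩
    ∑[ i < n ] ∑[ j < n ] (2 * (x i * x j))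
      ≤⟨ sum-mono-≤ _ _ (λ i → sum-mono-≤ _ _ (λ j → 2xy≤x²+y² (x i) (x j))) ⟩
    ∑[ i < n ] ∑[ j < n ] (x² i + x² j)          ≡⟨ sum-cong-≗ (λ i → ∑-distrib-+ (λ _ → x² i) x²) ⟩
    ∑[ i < n ] (∑[ j < n ] x² i + S)             ≡⟨ ∑-distrib-+ (λ i → ∑[ j < n ] x² i) (λ _ → S) ⟩
    ∑[ i < n ] ∑[ j < n ] x² i + ∑[ i < n ] S    ≡⟨ cong₂ _+_ (sum-cong-≗ (λ i → sum-const n (x² i))) (sum-const n S) ⟩
    ∑[ i < n ] (n * x² i) + n * S                ≡⟨ cong (_+ n * S) (*-distribˡ-sum n x²) ⟨
    n * S + n * S                                ≡⟨ cong (n * S +_) (+-identityʳ (n * S)) ⟨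
    2 * (n * S)                                  ∎)
    where
    open ≤-Reasoning
    x² : Fin n → ℕ
    x² i = x i * x i
    S = sum x²

  ∑-comm₃ : ∀ {l m n} (f : Fin l → Fin m → Fin n → ℕ) →
            ∑[ a < l ] ∑[ b < m ] ∑[ c < n ] f a b c ≡ ∑[ b < m ] ∑[ c < n ] ∑[ a < l ] f a b c
  ∑-comm₃ f = trans (∑-comm (λ a b → ∑[ c < _ ] f a b c)) (sum-cong-≗ (λ b → ∑-comm (λ a c → f a b c)))

  δ : ∀ {k} → Fin k → Fin k → ℕ
  δ a b = if does (a ≟ b) then 1 else 0

  δ≤1 : ∀ {k} (a b : Fin k) → δ a b ≤ 1
  δ≤1 a b with a ≟ b
  ... | yes _ = ≤-refl
  ... | no _  = z≤n

  δ*δ≤1 : ∀ {k} (a b i : Fin k) → δ a i * δ b i ≤ 1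
  δ*δ≤1 a b i = *-mono-≤ (δ≤1 a i) (δ≤1 b i)

  δ*δ-pos : ∀ {k} {a b i : Fin k} → 1 ≤ δ a i * δ b i → a ≡ i × b ≡ i
  δ*δ-pos {a = a} {b} {i} pos with a ≟ i | b ≟ i
  ... | yes a≡i | yes b≡i = a≡i , b≡i
  ... | yes _   | no _    = contradiction pos (λ ())
  ... | no _    | _       = contradiction pos (λ ())

  sum-δ : ∀ {k} (a : Fin k) → ∑[ i < k ] δ a i ≡ 1
  sum-δ {suc k} zero    = cong suc (sum-0 k)
  sum-δ {suc k} (suc a) = sum-δ a

  δ≡sum-δ*δ : ∀ {k} (a b : Fin k) → δ a b ≡ ∑[ i < k ] (δ a i * δ b i)
  δ≡sum-δ*δ {suc k} zero    zero    = cong suc (sym (sum-0 k))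
  δ≡sum-δ*δ {suc k} zero    (suc b) = sym (sum-0 k)
  δ≡sum-δ*δ {suc k} (suc a) zero    = sym (trans (sum-cong-≗ (λ i → *-zeroʳ (δ a i))) (sum-0 k))
  δ≡sum-δ*δ {suc k} (suc a) (suc b) = δ≡sum-δ*δ a b

  module _ {m n k} (c : Fin m → Fin n → Fin k) where

    count : Fin m → Fin k → ℕ
    count r i = ∑[ j < n ] δ (c r j) i

    agreements : Fin n → Fin n → ℕ
    agreements j j′ = ∑[ r < m ] δ (c r j) (c r j′)

    sum-count : ∀ r → ∑[ i < k ] count r i ≡ n
    sum-count r = begin
      ∑[ i < k ] ∑[ j < n ] δ (c r j) i ≡⟨ ∑-comm (λ i j → δ (c r j) i) ⟩
      ∑[ j < n ] ∑[ i < k ] δ (c r j) i ≡⟨ sum-cong-≗ (λ j → sum-δ (c r j)) ⟩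
      ∑[ j < n ] 1                      ≡⟨ sum-const n 1 ⟩
      n * 1                             ≡⟨ *-identityʳ n ⟩
      n                                 ∎
      where open ≡-Reasoning

    n²≤k*∑count² : ∀ r → n * n ≤ k * ∑[ i < k ] (count r i * count r i)
    n²≤k*∑count² r = subst (λ s → s * s ≤ k * ∑[ i < k ] (count r i * count r i)) (sum-count r) (cauchy-schwarz (count r))

    -- Both sides count the triples (r , j , j′) with c r j ≡ c r j′.
    ∑count²≡∑agreements : ∑[ r < m ] ∑[ i < k ] (count r i * count r i) ≡ ∑[ j < n ] ∑[ j′ < n ] agreements j j′
    ∑count²≡∑agreements = begin
      ∑[ r < m ] ∑[ i < k ] (count r i * count r i)
        ≡⟨ sum-cong-≗ (λ r → sum-cong-≗ (λ i → sum-*-sum (λ j → δ (c r j) i) (λ j′ → δ (c r j′) i))) ⟩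
      ∑[ r < m ] ∑[ i < k ] ∑[ j < n ] ∑[ j′ < n ] (δ (c r j) i * δ (c r j′) i)
        ≡⟨ sum-cong-≗ (λ r → ∑-comm₃ (λ i j j′ → δ (c r j) i * δ (c r j′) i)) ⟩
      ∑[ r < m ] ∑[ j < n ] ∑[ j′ < n ] ∑[ i < k ] (δ (c r j) i * δ (c r j′) i)
        ≡⟨ sum-cong-≗ (λ r → sum-cong-≗ (λ j → sum-cong-≗ (λ j′ → sym (δ≡sum-δ*δ (c r j) (c r j′))))) ⟩
      ∑[ r < m ] ∑[ j < n ] ∑[ j′ < n ] δ (c r j) (c r j′)
        ≡⟨ ∑-comm₃ (λ r j j′ → δ (c r j) (c r j′)) ⟩
      ∑[ j < n ] ∑[ j′ < n ] agreements j j′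
        ∎
      where open ≡-Reasoning

    -- Distinct columns j, j′ agree in at most one row per colour.
    agreements≤k : RectangleFree c → ∀ {j j′} → j ≢ j′ → agreements j j′ ≤ k
    agreements≤k rf {j} {j′} j≢j′ = begin
      ∑[ r < m ] δ (c r j) (c r j′)                            ≡⟨ sum-cong-≗ (λ r → δ≡sum-δ*δ (c r j) (c r j′)) ⟩
      ∑[ r < m ] ∑[ i < k ] (δ (c r j) i * δ (c r j′) i)     ≡⟨ ∑-comm (λ r i → δ (c r j) i * δ (c r j′) i) ⟩
      ∑[ i < k ] ∑[ r < m ] (δ (c r j) i * δ (c r j′) i)
        ≤⟨ sum-mono-≤ _ (λ _ → 1) (λ i → sum≤1 _ (λ r → δ*δ≤1 (c r j) (c r j′) i) (unique i)) ⟩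
      ∑[ i < k ] 1                                             ≡⟨ sum-const k 1 ⟩
      k * 1                                                    ≡⟨ *-identityʳ k ⟩
      k                                                        ∎
      where
      open ≤-Reasoning
      unique : ∀ i r r′ → 1 ≤ δ (c r j) i * δ (c r j′) i → 1 ≤ δ (c r′ j) i * δ (c r′ j′) i → r ≡ r′
      unique i r r′ pos pos′ with r ≟ r′ | δ*δ-pos pos | δ*δ-pos pos′
      ... | yes r≡r′ | _ | _ = r≡r′
      ... | no r≢r′ | c₁ , c₂ | c₃ , c₄ = ⊥-elim (rf r≢r′ j≢j′ c₁ c₂ c₃ c₄)

    agreements-diag≤m : ∀ j → agreements j j ≤ m
    agreements-diag≤m j = begin
      ∑[ r < m ] δ (c r j) (c r j) ≤⟨ sum-mono-≤ _ _ (λ r → δ≤1 (c r j) (c r j)) ⟩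
      ∑[ r < m ] 1                 ≡⟨ sum-const m 1 ⟩
      m * 1                        ≡⟨ *-identityʳ m ⟩
      m                            ∎
      where open ≤-Reasoning

    agreements≤ : RectangleFree c → ∀ j j′ → agreements j j′ ≤ k + δ j j′ * m
    agreements≤ rf j j′ with j ≟ j′
    ... | yes refl = ≤-trans (agreements-diag≤m j) (≤-trans (m≤m+n m 0) (m≤n+m (m + 0) k))
    ... | no j≢j′  = ≤-trans (agreements≤k rf j≢j′) (m≤m+n k 0)

    ∑agreements≤ : RectangleFree c → ∑[ j < n ] ∑[ j′ < n ] agreements j j′ ≤ n * (n * k + 1 * m)
    ∑agreements≤ rf = begin
      ∑[ j < n ] ∑[ j′ < n ] agreements j j′     ≤⟨ sum-mono-≤ _ _ (λ j → sum-mono-≤ _ _ (agreements≤ rf j)) ⟩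
      ∑[ j < n ] ∑[ j′ < n ] (k + δ j j′ * m)    ≡⟨ sum-cong-≗ row-sum ⟩
      ∑[ j < n ] (n * k + 1 * m)                 ≡⟨ sum-const n _ ⟩
      n * (n * k + 1 * m)                        ∎
      where
      open ≤-Reasoning
      row-sum : ∀ j → ∑[ j′ < n ] (k + δ j j′ * m) ≡ n * k + 1 * m
      row-sum j = begin-equality
        ∑[ j′ < n ] (k + δ j j′ * m)               ≡⟨ ∑-distrib-+ (λ _ → k) (λ j′ → δ j j′ * m) ⟩
        ∑[ j′ < n ] k + ∑[ j′ < n ] (δ j j′ * m)   ≡⟨ cong₂ _+_ (sum-const n k) (sym (*-distribʳ-sum m (δ j))) ⟩
        n * k + (∑[ j′ < n ] δ j j′) * m           ≡⟨ cong (λ s → n * k + s * m) (sum-δ j) ⟩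
        n * k + 1 * m                              ∎

    n*[m*n]≤n*[k*[k*n+m]] : RectangleFree c → n * (m * n) ≤ n * (k * (k * n + m))
    n*[m*n]≤n*[k*[k*n+m]] rf = begin
      n * (m * n)                                                ≡⟨ solve (m ∷ n ∷ []) ⟩
      m * (n * n)                                                ≡⟨ sum-const m (n * n) ⟨
      ∑[ r < m ] (n * n)                                         ≤⟨ sum-mono-≤ _ _ n²≤k*∑count² ⟩
      ∑[ r < m ] (k * ∑[ i < k ] (count r i * count r i))        ≡⟨ *-distribˡ-sum k (λ r → ∑[ i < k ] (count r i * count r i)) ⟨
      k * ∑[ r < m ] ∑[ i < k ] (count r i * count r i)          ≡⟨ cong (k *_) ∑count²≡∑agreements ⟩
      k * ∑[ j < n ] ∑[ j′ < n ] agreements j j′                 ≤⟨ *-monoʳ-≤ k (∑agreements≤ rf) ⟩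
      k * (n * (n * k + 1 * m))                                  ≡⟨ solve (m ∷ n ∷ k ∷ []) ⟩
      n * (k * (k * n + m))                                      ∎
      where open ≤-Reasoning

  rectangleFree⇒m*n≤k*[k*n+m] : ∀ {m n k} (c : Fin m → Fin n → Fin k) → RectangleFree c →
                                m * n ≤ k * (k * n + m)
  rectangleFree⇒m*n≤k*[k*n+m] {m} {zero}  {k} c rf = subst (_≤ k * (k * 0 + m)) (sym (*-zeroʳ m)) z≤n
  rectangleFree⇒m*n≤k*[k*n+m] {m} {suc n} {k} c rf = *-cancelˡ-≤ (suc n) (n*[m*n]≤n*[k*[k*n+m]] c rf)

  rectangleFree⇒n≤k*[1+k] : ∀ {n k} (c : Fin n → Fin n → Fin k) → RectangleFree c → n ≤ k * suc k
  rectangleFree⇒n≤k*[1+k] {zero}  c rf = z≤n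
  rectangleFree⇒n≤k*[1+k] {suc n} {k} c rf =
    *-cancelˡ-≤ (suc n) (subst (suc n * suc n ≤_) (regroup (suc n) k) (rectangleFree⇒m*n≤k*[k*n+m] c rf))
    where
    regroup : ∀ n k → k * (k * n + n) ≡ n * (k * suc k)
    regroup = solve-∀

module LineColouring where

  open import Data.Nat as ℕ using (ℕ; zero; suc; NonZero)
  import Data.Nat.Properties as ℕ
  open import Data.Nat.Divisibility as ℕ using (divides; ∣⇒≤)
  open import Data.Nat.Primality using (Prime; euclidsLemma; prime⇒nonZero)
  open import Data.Integer using (ℤ; +_; _+_; _*_; _-_; ∣_∣; _%ℕ_; _/ℕ_)
  open import Data.Integer.Properties using (abs-*; ∣m⊝n∣≤m⊔n; [+m]-[+n]≡m⊖n; ∣i∣≡0⇒i≡0; i-j≡0⇒i≡j; +-injective)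
  open import Data.Integer.DivMod using (a≡a%ℕn+[a/ℕn]*n; n%ℕd<d)
  open import Data.Integer.Tactic.RingSolver using (solve)
  open import Data.Fin using (Fin; toℕ; fromℕ<; inject≤; remQuot; combine)
  open import Data.Fin.Properties using (toℕ-fromℕ<; toℕ-injective; toℕ<n; inject≤-injective; combine-remQuot)
  open import Data.Product using (Σ; ∃-syntax; _×_; _,_; uncurry; curry)
  open import Data.Sum using (inj₁; inj₂)
  open import Data.List using (_∷_; [])
  open import Function using (_∘_)
  open import Function.Definitions using (Injective)
  open import Relation.Binary.PropositionalEquality
  open import Relation.Nullary using (contradiction)
  open Visibility using (RectangleFree; rectangleFree-∘)

  infix 4 _∣ℤ_
  _∣ℤ_ : ℤ → ℤ → Set
  d ∣ℤ z = ∃[ q ] z ≡ q * d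

  ∣ℤ-− : ∀ {d a b} → d ∣ℤ a → d ∣ℤ b → d ∣ℤ (a - b)
  ∣ℤ-− {d} (q , refl) (q′ , refl) = q - q′ , solve (q ∷ q′ ∷ d ∷ [])

  ∣ℤ⇒∣∣∣ : ∀ {d z} → d ∣ℤ z → ∣ d ∣ ℕ.∣ ∣ z ∣
  ∣ℤ⇒∣∣∣ {d} (q , refl) = divides ∣ q ∣ (abs-* q d)

  %ℕ≡⇒∣ℤ- : ∀ p .{{_ : NonZero p}} a b → a %ℕ p ≡ b %ℕ p → + p ∣ℤ a - b
  %ℕ≡⇒∣ℤ- p a b eq = qa - qb , (begin
    a - b                                     ≡⟨ cong₂ _-_ (a≡a%ℕn+[a/ℕn]*n a p) (a≡a%ℕn+[a/ℕn]*n b p) ⟩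
    (ra + qa * + p) - (+ (b %ℕ p) + qb * + p) ≡⟨ cong (λ r → (ra + qa * + p) - (+ r + qb * + p)) (sym eq) ⟩
    (ra + qa * + p) - (ra + qb * + p)         ≡⟨ cancel ra qa qb (+ p) ⟩
    (qa - qb) * + p                           ∎)
    where
    open ≡-Reasoning
    ra = + (a %ℕ p)
    qa = a /ℕ p
    qb = b /ℕ p
    cancel : ∀ r x y d → (r + x * d) - (r + y * d) ≡ (x - y) * d
    cancel r x y d = solve (r ∷ x ∷ y ∷ d ∷ [])

  ∣∧<⇒≡0 : ∀ {p x} → p ℕ.∣ x → x ℕ.< p → x ≡ 0
  ∣∧<⇒≡0 {x = zero}  _   _   = refl
  ∣∧<⇒≡0 {x = suc x} p∣x x<p = contradiction (∣⇒≤ p∣x) (ℕ.<⇒≱ x<p)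

  ∣∣+a-+b∣∧<⇒≡ : ∀ {p a b} → a ℕ.< p → b ℕ.< p → p ℕ.∣ ∣ + a - + b ∣ → a ≡ b
  ∣∣+a-+b∣∧<⇒≡ {p} {a} {b} a<p b<p p∣ =
    +-injective (i-j≡0⇒i≡j _ _ (∣i∣≡0⇒i≡0 (∣∧<⇒≡0 p∣ ∣+a-+b∣<p)))
    where
    ∣+a-+b∣<p : ∣ + a - + b ∣ ℕ.< p
    ∣+a-+b∣<p = ℕ.≤-<-trans (subst (ℕ._≤ a ℕ.⊔ b) (cong ∣_∣ (sym ([+m]-[+n]≡m⊖n a b))) (∣m⊝n∣≤m⊔n a b))
                            (ℕ.⊔-pres-<m a<p b<p)

  fin-∣∣-∣⇒≡ : ∀ {p} {a b : Fin p} → p ℕ.∣ ∣ + toℕ a - + toℕ b ∣ → a ≡ b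
  fin-∣∣-∣⇒≡ {a = a} {b} = toℕ-injective ∘ ∣∣+a-+b∣∧<⇒≡ (toℕ<n a) (toℕ<n b)

  module _ {p : ℕ} (p-prime : Prime p) where

    private instance
      p≢0 : NonZero p
      p≢0 = prime⇒nonZero p-prime

    Point : Set
    Point = Fin p × Fin p

    -- ℓ = (s , t) is the line y = s x + t of 𝔽ₚ², and P = (x , y) lies on the
    -- translate of ℓ by its colour.
    offset : Point → Point → ℤ
    offset (s , t) (x , y) = + toℕ y - + toℕ s * + toℕ x - + toℕ t

    lineColour : Point → Point → Fin p
    lineColour ℓ P = fromℕ< (n%ℕd<d (offset ℓ P) p)

    lineColour≡⇒∣ℤ : ∀ ℓ P ℓ′ P′ → lineColour ℓ P ≡ lineColour ℓ′ P′ →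
                     + p ∣ℤ offset ℓ P - offset ℓ′ P′
    lineColour≡⇒∣ℤ ℓ P ℓ′ P′ eq = %ℕ≡⇒∣ℤ- p (offset ℓ P) (offset ℓ′ P′) (begin
      offset ℓ P %ℕ p                  ≡⟨ toℕ-fromℕ< (n%ℕd<d (offset ℓ P) p) ⟨
      toℕ (lineColour ℓ P)             ≡⟨ cong toℕ eq ⟩
      toℕ (lineColour ℓ′ P′)           ≡⟨ toℕ-fromℕ< (n%ℕd<d (offset ℓ′ P′) p) ⟩
      offset ℓ′ P′ %ℕ p                ∎)
      where open ≡-Reasoning

    -- Equal colours in two rows at two columns give p ∣ (s − s′)(x′ − x): equal slopes
    -- then force equal intercepts, equal abscissae force equal ordinates.
    lineColour-rectangleFree : RectangleFree lineColour
    lineColour-rectangleFree {s , t} {s′ , t′} {x , y} {x′ , y′} ℓ≢ℓ′ P≢P′ c₁ c₂ c₃ c₄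
      with euclidsLemma ∣ S - S′ ∣ ∣ X′ - X ∣ p-prime
             (subst (p ℕ.∣_) (abs-* (S - S′) (X′ - X))
               (∣ℤ⇒∣∣∣ (subst (+ p ∣ℤ_) (slopes×abscissae S T S′ T′ X Y X′ Y′) (∣ℤ-− d₁ d₂))))
      where
      S = + toℕ s ; T = + toℕ t ; S′ = + toℕ s′ ; T′ = + toℕ t′
      X = + toℕ x ; Y = + toℕ y ; X′ = + toℕ x′ ; Y′ = + toℕ y′
      d₁ = lineColour≡⇒∣ℤ (s , t) (x , y) (s′ , t′) (x , y) (trans c₁ (sym c₃))
      d₂ = lineColour≡⇒∣ℤ (s , t) (x′ , y′) (s′ , t′) (x′ , y′) (trans c₂ (sym c₄))
      slopes×abscissae : ∀ S T S′ T′ X Y X′ Y′ →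
        ((Y - S * X - T) - (Y - S′ * X - T′)) - ((Y′ - S * X′ - T) - (Y′ - S′ * X′ - T′)) ≡ (S - S′) * (X′ - X)
      slopes×abscissae S T S′ T′ X Y X′ Y′ = solve (S ∷ T ∷ S′ ∷ T′ ∷ X ∷ Y ∷ X′ ∷ Y′ ∷ [])
    ... | inj₁ p∣Δs with fin-∣∣-∣⇒≡ {a = s} {s′} p∣Δs
    ...   | refl = ℓ≢ℓ′ (cong (s ,_) (sym (fin-∣∣-∣⇒≡ (∣ℤ⇒∣∣∣ Δt))))
      where
      intercepts : ∀ S T T′ X Y → (Y - S * X - T) - (Y - S * X - T′) ≡ T′ - T
      intercepts S T T′ X Y = solve (S ∷ T ∷ T′ ∷ X ∷ Y ∷ [])
      Δt : + p ∣ℤ + toℕ t′ - + toℕ t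
      Δt = subst (+ p ∣ℤ_) (intercepts (+ toℕ s) (+ toℕ t) (+ toℕ t′) (+ toℕ x) (+ toℕ y))
             (lineColour≡⇒∣ℤ (s , t) (x , y) (s , t′) (x , y) (trans c₁ (sym c₃)))
    lineColour-rectangleFree {s , t} {s′ , t′} {x , y} {x′ , y′} ℓ≢ℓ′ P≢P′ c₁ c₂ c₃ c₄
      | inj₂ p∣Δx with fin-∣∣-∣⇒≡ {a = x′} {x} p∣Δx
    ...   | refl = P≢P′ (cong (x ,_) (fin-∣∣-∣⇒≡ (∣ℤ⇒∣∣∣ Δy)))
      where
      ordinates : ∀ S T X Y Y′ → (Y - S * X - T) - (Y′ - S * X - T) ≡ Y - Y′
      ordinates S T X Y Y′ = solve (S ∷ T ∷ X ∷ Y ∷ Y′ ∷ [])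
      Δy : + p ∣ℤ + toℕ y - + toℕ y′
      Δy = subst (+ p ∣ℤ_) (ordinates (+ toℕ s) (+ toℕ t) (+ toℕ x) (+ toℕ y) (+ toℕ y′))
             (lineColour≡⇒∣ℤ (s , t) (x , y) (s , t) (x , y′) (trans c₁ (sym c₂)))

  embed : ∀ {n} p → n ℕ.≤ p ℕ.* p → Fin n → Fin p × Fin p
  embed p n≤p² r = remQuot {p} p (inject≤ r n≤p²)

  embed-injective : ∀ {n} p (n≤p² : n ℕ.≤ p ℕ.* p) → Injective _≡_ _≡_ (embed p n≤p²)
  embed-injective p n≤p² {r} {r′} eq = inject≤-injective n≤p² n≤p² r r′ (begin
    inject≤ r n≤p²                                     ≡⟨ combine-remQuot {p} p (inject≤ r n≤p²) ⟨
    uncurry combine (remQuot {p} p (inject≤ r n≤p²))   ≡⟨ cong (uncurry combine) eq ⟩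
    uncurry combine (remQuot {p} p (inject≤ r′ n≤p²))  ≡⟨ combine-remQuot {p} p (inject≤ r′ n≤p²) ⟩
    inject≤ r′ n≤p²                                    ∎)
    where open ≡-Reasoning

  rectangleFreeColouring : ∀ {n p} → Prime p → n ℕ.≤ p ℕ.* p → Σ (Fin n × Fin n → Fin p) (RectangleFree ∘ curry)
  rectangleFreeColouring {p = p} p-prime n≤p² =
    (λ (r , c) → lineColour p-prime (embed p n≤p² r) (embed p n≤p² c)) ,
    rectangleFree-∘ (lineColour p-prime) (embed-injective p n≤p²) (embed-injective p n≤p²) (lineColour-rectangleFree p-prime)

module Binomial where

  open import Data.Nat
  open import Data.Nat.Properties
  open import Data.Nat.Divisibility
  open import Data.Nat.Primality using (Prime; euclidsLemma; prime⇒nonTrivial)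
  open import Data.Sum using (inj₁; inj₂)
  open import Data.Product using (_,_)
  open import Relation.Nullary using (contradiction)
  open import Data.Nat.Tactic.RingSolver using (solve; solve-∀)
  open import Data.List using (_∷_; [])
  open import Algebra.Properties.CommutativeSemigroup *-commutativeSemigroup using (x∙yz≈y∙xz)
  open import Relation.Binary.PropositionalEquality

  infix 8 _choose_
  _choose_ : ℕ → ℕ → ℕ
  n     choose zero  = 1
  zero  choose suc k = 0
  suc n choose suc k = n choose k + n choose suc k

  choose-1 : ∀ n → n choose 1 ≡ n
  choose-1 zero    = refl
  choose-1 (suc n) = cong suc (choose-1 n)

  choose-absorb : ∀ n k → suc k * (suc n choose suc k) ≡ suc n * (n choose k)
  choose-absorb zero    zero    = refl
  choose-absorb zero    (suc k) = *-zeroʳ (suc (suc k))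
  choose-absorb (suc n) zero    = trans (+-identityʳ _) (trans (choose-1 (suc (suc n))) (sym (*-identityʳ _)))
  choose-absorb (suc n) (suc k) = begin
    suc (suc k) * (X + Y)                   ≡⟨ *-distribˡ-+ (suc (suc k)) X Y ⟩
    X + suc k * X + suc (suc k) * Y         ≡⟨ cong₂ (λ a b → X + a + b) (choose-absorb n k) (choose-absorb n (suc k)) ⟩
    X + suc n * W + suc n * Z               ≡⟨ +-assoc X _ _ ⟩
    X + (suc n * W + suc n * Z)             ≡⟨ cong (X +_) (*-distribˡ-+ (suc n) W Z) ⟨
    X + suc n * (W + Z)                     ∎
    where
    open ≡-Reasoning
    X = suc n choose suc k
    Y = suc n choose suc (suc k)
    W = n choose k
    Z = n choose suc k

  choose-absorbᶜ : ∀ k j → suc j * (suc (k + j) choose k) ≡ suc (k + j) * ((k + j) choose k)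
  choose-absorbᶜ k j = +-cancelˡ-≡ (k * X) _ _ (begin
    k * X + suc j * X                          ≡⟨ *-distribʳ-+ X k (suc j) ⟨
    (k + suc j) * X                            ≡⟨ cong (_* X) (+-suc k j) ⟩
    suc (k + j) * X                            ≡⟨ weighted (k + j) k ⟩
    suc (k + j) * ((k + j) choose k) + k * X   ≡⟨ +-comm _ (k * X) ⟩
    k * X + suc (k + j) * ((k + j) choose k)   ∎)
    where
    open ≡-Reasoning
    X = suc (k + j) choose k
    weighted : ∀ n i → suc n * (suc n choose i) ≡ suc n * (n choose i) + i * (suc n choose i)
    weighted n zero    = sym (+-identityʳ _)
    weighted n (suc i) = begin
      suc n * (n choose i + n choose suc i)                 ≡⟨ *-distribˡ-+ (suc n) (n choose i) _ ⟩
      suc n * (n choose i) + suc n * (n choose suc i)       ≡⟨ +-comm (suc n * (n choose i)) _ ⟩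
      suc n * (n choose suc i) + suc n * (n choose i)       ≡⟨ cong (suc n * (n choose suc i) +_) (choose-absorb n i) ⟨
      suc n * (n choose suc i) + suc i * (suc n choose suc i) ∎

  choose-factorials : ∀ k j → (k + j) choose k * (k ! * j !) ≡ (k + j) !
  choose-factorials zero    j = trans (*-identityˡ _) (*-identityˡ _)
  choose-factorials (suc k) j = begin
    (suc n choose suc k) * (suc k * k ! * j !)   ≡⟨ regroup (suc n choose suc k) (suc k) (k !) (j !) ⟩
    suc k * (suc n choose suc k) * (k ! * j !)   ≡⟨ cong (_* (k ! * j !)) (choose-absorb n k) ⟩
    suc n * (n choose k) * (k ! * j !)           ≡⟨ *-assoc (suc n) (n choose k) (k ! * j !) ⟩
    suc n * (n choose k * (k ! * j !))           ≡⟨ cong (suc n *_) (choose-factorials k j) ⟩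
    suc n * n !                                  ∎
    where
    open ≡-Reasoning
    n = k + j
    regroup : ∀ c a f g → c * (a * f * g) ≡ a * c * (f * g)
    regroup = solve-∀

  1≤choose : ∀ k j → 1 ≤ (k + j) choose k
  1≤choose zero    j = s≤s z≤n
  1≤choose (suc k) j = ≤-trans (1≤choose k j) (m≤m+n _ _)

  prime⇒>1 : ∀ {p} → Prime p → 1 < p
  prime⇒>1 {p} p-prime = nonTrivial⇒n>1 p {{prime⇒nonTrivial p-prime}}

  ∣! : ∀ {m n} → 1 ≤ m → m ≤ n → m ∣ n !
  ∣! {suc m} _ m≤n = ∣-trans (m∣m*n (m !)) (m≤n⇒m!∣n! m≤n)

  prime∣!⇒≤ : ∀ {p} → Prime p → ∀ n → p ∣ n ! → p ≤ n
  prime∣!⇒≤ p-prime zero    p∣1 = contradiction (∣1⇒≡1 p∣1) (>⇒≢ (prime⇒>1 p-prime))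
  prime∣!⇒≤ p-prime (suc n) p∣n! with euclidsLemma (suc n) (n !) p-prime p∣n!
  ... | inj₁ p∣1+n = ∣⇒≤ p∣1+n
  ... | inj₂ p∣n!  = m≤n⇒m≤1+n (prime∣!⇒≤ p-prime n p∣n!)

  -- p divides (k + j)! = (k + j choose k) · k! · j! but neither k! nor j!.
  prime∣choose : ∀ {p} → Prime p → ∀ k j → k < p → j < p → p ≤ k + j → p ∣ (k + j) choose k
  prime∣choose p-prime k j k<p j<p p≤k+j
    with euclidsLemma ((k + j) choose k) (k ! * j !) p-prime
           (subst (_ ∣_) (sym (choose-factorials k j)) (∣! (<⇒≤ (prime⇒>1 p-prime)) p≤k+j))
  ... | inj₁ p∣choose = p∣choose
  ... | inj₂ p∣k!j! with euclidsLemma (k !) (j !) p-prime p∣k!j!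
  ...   | inj₁ p∣k! = contradiction (prime∣!⇒≤ p-prime k p∣k!) (<⇒≱ k<p)
  ...   | inj₂ p∣j! = contradiction (prime∣!⇒≤ p-prime j p∣j!) (<⇒≱ j<p)

  choose-absorb₂ : ∀ k j → suc k * (suc j * (suc (suc (k + j)) choose suc k)) ≡
                           suc (suc (k + j)) * (suc (k + j) * ((k + j) choose k))
  choose-absorb₂ k j = begin
    suc k * (suc j * (suc (suc n) choose suc k))   ≡⟨ x∙yz≈y∙xz (suc k) (suc j) (suc (suc n) choose suc k) ⟩
    suc j * (suc k * (suc (suc n) choose suc k))   ≡⟨ cong (suc j *_) (choose-absorb (suc n) k) ⟩
    suc j * (suc (suc n) * (suc n choose k))       ≡⟨ x∙yz≈y∙xz (suc j) (suc (suc n)) (suc n choose k) ⟩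
    suc (suc n) * (suc j * (suc n choose k))       ≡⟨ cong (suc (suc n) *_) (choose-absorbᶜ k j) ⟩
    suc (suc n) * (suc n * (n choose k))           ∎
    where
    open ≡-Reasoning
    n = k + j

  4^m≤[2m+1]*central : ∀ m → 4 ^ m ≤ suc (m + m) * ((m + m) choose m)
  4^m≤[2m+1]*central zero    = ≤-refl
  4^m≤[2m+1]*central (suc m) = *-cancelˡ-≤ (suc m * suc m) (begin
    suc m * suc m * (4 * 4 ^ m)                              ≡⟨ rearrange₁ m (4 ^ m) ⟩
    (4 * suc m) * suc m * 4 ^ m                              ≤⟨ *-monoˡ-≤ (4 ^ m) (*-monoˡ-≤ (suc m) 4[m+1]≤2[2m+3]) ⟩
    2 * suc (suc (suc (m + m))) * suc m * 4 ^ m              ≤⟨ *-monoʳ-≤ (2 * suc (suc (suc (m + m))) * suc m) (4^m≤[2m+1]*central m) ⟩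
    2 * suc (suc (suc (m + m))) * suc m * (suc (m + m) * c)  ≡⟨ rearrange₂ m c ⟩
    suc (suc (suc (m + m))) * (suc (suc (m + m)) * (suc (m + m) * c)) ≡⟨ cong (suc (suc (suc (m + m))) *_) (choose-absorb₂ m m) ⟨
    suc (suc (suc (m + m))) * (suc m * (suc m * c′))        ≡⟨ rearrange₃ m c′ ⟩
    suc m * suc m * (suc (suc (suc (m + m))) * c′)
      ≡⟨ cong (λ n → suc m * suc m * (suc (suc n) * (suc n choose suc m))) (+-suc m m) ⟨
    suc m * suc m * (suc (suc m + suc m) * (suc m + suc m) choose suc m) ∎)
    where
    open ≤-Reasoning
    c  = (m + m) choose m
    c′ = suc (suc (m + m)) choose suc m
    4[m+1]≤2[2m+3] : 4 * suc m ≤ 2 * suc (suc (suc (m + m)))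
    4[m+1]≤2[2m+3] = ≤-trans (m≤m+n (4 * suc m) 2) (≤-reflexive (solve (m ∷ [])))
    rearrange₁ : ∀ m x → suc m * suc m * (4 * x) ≡ 4 * suc m * suc m * x
    rearrange₁ = solve-∀
    rearrange₂ : ∀ m c → 2 * suc (suc (suc (m + m))) * suc m * (suc (m + m) * c) ≡
                         suc (suc (suc (m + m))) * (suc (suc (m + m)) * (suc (m + m) * c))
    rearrange₂ = solve-∀
    rearrange₃ : ∀ m c′ → suc (suc (suc (m + m))) * (suc m * (suc m * c′)) ≡
                          suc m * suc m * (suc (suc (suc (m + m))) * c′)
    rearrange₃ = solve-∀

  [2m+1]choose[m]≤4^m : ∀ m → suc (m + m) choose m ≤ 4 ^ m
  [2m+1]choose[m]≤4^m zero    = ≤-refl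
  [2m+1]choose[m]≤4^m (suc m) = *-cancelˡ-≤ (suc m * suc (suc m)) (begin
    suc m * suc (suc m) * o′                                               ≡⟨ *-assoc (suc m) (suc (suc m)) o′ ⟩
    suc m * (suc (suc m) * o′)                                             ≡⟨ choose-absorb₂ m (suc m) ⟩
    suc (suc (m + suc m)) * (suc (m + suc m) * ((m + suc m) choose m))
      ≡⟨ cong (λ n → suc (suc n) * (suc n * (n choose m))) (+-suc m m) ⟩
    suc (suc (suc (m + m))) * (suc (suc (m + m)) * o)                      ≡⟨ rearrange₁ m o ⟩
    2 * suc (suc (suc (m + m))) * suc m * o                                ≤⟨ *-monoˡ-≤ o (*-monoˡ-≤ (suc m) 2[2m+3]≤4[m+2]) ⟩
    4 * suc (suc m) * suc m * o
      ≤⟨ *-monoʳ-≤ (4 * suc (suc m) * suc m) ([2m+1]choose[m]≤4^m m) ⟩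
    4 * suc (suc m) * suc m * 4 ^ m                                        ≡⟨ rearrange₂ m (4 ^ m) ⟩
    suc m * suc (suc m) * (4 * 4 ^ m)                                      ∎)
    where
    open ≤-Reasoning
    o  = suc (m + m) choose m
    o′ = suc (suc m + suc m) choose suc m
    2[2m+3]≤4[m+2] : 2 * suc (suc (suc (m + m))) ≤ 4 * suc (suc m)
    2[2m+3]≤4[m+2] = ≤-trans (m≤m+n (2 * suc (suc (suc (m + m)))) 2) (≤-reflexive (solve (m ∷ [])))
    rearrange₁ : ∀ m o → suc (suc (suc (m + m))) * (suc (suc (m + m)) * o) ≡ 2 * suc (suc (suc (m + m))) * suc m * o
    rearrange₁ = solve-∀
    rearrange₂ : ∀ m x → 4 * suc (suc m) * suc m * x ≡ suc m * suc (suc m) * (4 * x)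
    rearrange₂ = solve-∀

  -- If 1/c = 1/a - 1/b, i.e. a b + c a = c b, then a ∣ M and b ∣ M force c ∣ M:
  -- M/c = M/a - M/b.
  harmonic-∣ : ∀ {a b c M} .{{_ : NonZero a}} → a * b + c * a ≡ c * b → a ∣ M → b ∣ M → c ∣ M
  harmonic-∣ {a} {b} {c} identity (divides A M≡Aa) (divides B refl) = divides (A ∸ B) (begin
    B * b                  ≡⟨ m+n∸n≡m (B * b) (B * c) ⟨
    B * b + B * c ∸ B * c  ≡⟨ cong (_∸ B * c) (*-cancelˡ-≡ _ _ a key) ⟩
    A * c ∸ B * c          ≡⟨ *-distribʳ-∸ c A B ⟨
    (A ∸ B) * c            ∎)
    where
    open ≡-Reasoning
    key : a * (B * b + B * c) ≡ a * (A * c)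
    key = begin
      a * (B * b + B * c)  ≡⟨ regroup₁ a b c B ⟩
      B * (a * b + c * a)  ≡⟨ cong (B *_) identity ⟩
      B * (c * b)          ≡⟨ x∙yz≈y∙xz B c b ⟩
      c * (B * b)          ≡⟨ cong (c *_) M≡Aa ⟩
      c * (A * a)          ≡⟨ regroup₂ c A a ⟩
      a * (A * c)          ∎
      where
      regroup₁ : ∀ a b c B → a * (B * b + B * c) ≡ B * (a * b + c * a)
      regroup₁ = solve-∀
      regroup₂ : ∀ c A a → c * (A * a) ≡ a * (A * c)
      regroup₂ = solve-∀

  -- 1 / leibniz n k is the entry in row n, place k of Leibniz's harmonic triangle.
  leibniz : ℕ → ℕ → ℕ
  leibniz n k = suc n * n choose k

  leibniz-rule : ∀ k j → let n = k + j; a = leibniz n k; b = leibniz (suc n) k; c = leibniz (suc n) (suc k) in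
                 a * b + c * a ≡ c * b
  leibniz-rule k j = *-cancelˡ-≡ _ _ (suc (suc n)) (begin
    suc (suc n) * (a * b + c * a)                 ≡⟨ regroup₁ (suc (suc n)) a b c ⟩
    suc (suc n) * a * b + suc (suc n) * a * c     ≡⟨ cong₂ (λ x y → x * b + y * c) E₁ E₂ ⟨
    suc k * c * b + suc j * b * c                 ≡⟨ regroup₂ k j b c ⟩
    (suc k + suc j) * (c * b)                     ≡⟨ cong (λ m → suc m * (c * b)) (+-suc k j) ⟩
    suc (suc n) * (c * b)                         ∎)
    where
    open ≡-Reasoning
    n = k + j
    a = leibniz n k
    b = leibniz (suc n) k
    c = leibniz (suc n) (suc k)
    E₁ : suc k * c ≡ suc (suc n) * a
    E₁ = trans (x∙yz≈y∙xz (suc k) (suc (suc n)) (suc n choose suc k)) (cong (suc (suc n) *_) (choose-absorb n k))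
    E₂ : suc j * b ≡ suc (suc n) * a
    E₂ = trans (x∙yz≈y∙xz (suc j) (suc (suc n)) (suc n choose k)) (cong (suc (suc n) *_) (choose-absorbᶜ k j))
    regroup₁ : ∀ N a b c → N * (a * b + c * a) ≡ N * a * b + N * a * c
    regroup₁ = solve-∀
    regroup₂ : ∀ k j b c → suc k * c * b + suc j * b * c ≡ (suc k + suc j) * (c * b)
    regroup₂ = solve-∀

  leibniz∣ : ∀ {N M} → (∀ i → 1 ≤ i → i ≤ N → i ∣ M) → ∀ k n → k ≤ n → n < N → leibniz n k ∣ M
  leibniz∣ {M = M} all∣M zero n _ n<N = subst (_∣ M) (sym (*-identityʳ (suc n))) (all∣M (suc n) (s≤s z≤n) n<N)
  leibniz∣ all∣M (suc k) (suc n) (s≤s k≤n) n<N with m≤n⇒∃[o]m+o≡n k≤n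
  ... | j , refl = harmonic-∣ {{leibniz≢0}} (leibniz-rule k j)
                     (leibniz∣ all∣M k (k + j) k≤n (<-trans (n<1+n _) n<N))
                     (leibniz∣ all∣M k (suc (k + j)) (m≤n⇒m≤1+n k≤n) n<N)
    where
    leibniz≢0 : NonZero (leibniz (k + j) k)
    leibniz≢0 = >-nonZero (*-mono-≤ (s≤s (z≤n {k + j})) (1≤choose k j))

  divisibleUpTo[2m+1]⇒4^m≤ : ∀ {m M} .{{_ : NonZero M}} → (∀ i → 1 ≤ i → i ≤ suc (m + m) → i ∣ M) → 4 ^ m ≤ M
  divisibleUpTo[2m+1]⇒4^m≤ {m} all∣M =
    ≤-trans (4^m≤[2m+1]*central m) (∣⇒≤ (leibniz∣ all∣M m (m + m) (m≤m+n m m) ≤-refl))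

module Primes where

  open import Data.Nat
  open import Data.Nat.Properties
  open import Data.Nat.Divisibility
  open import Data.Nat.Primality using (Prime; prime?; euclidsLemma; prime⇒irreducible; prime⇒nonZero)
  open import Data.Nat.Induction using (<-wellFounded)
  open import Data.Nat.Primality.Factorisation using (factorise)
  open import Data.Nat.ListAction using (product)
  open import Data.List using ([]; _∷_)
  open import Data.List.Relation.Unary.All using (_∷_)
  open import Induction.WellFounded using (Acc; acc)
  open import Data.Product using (∃-syntax; _×_; _,_; proj₂)
  open import Data.Sum using (inj₁; inj₂)
  open import Relation.Nullary using (¬_; yes; no; contradiction)
  open import Relation.Binary.PropositionalEquality
  open Binomial

  primeOrOne : ℕ → ℕ
  primeOrOne q with prime? q
  ... | yes _ = q
  ... | no  _ = 1

  primeOrOne-prime : ∀ {q} → Prime q → primeOrOne q ≡ q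
  primeOrOne-prime {q} q-prime with prime? q
  ... | yes _       = refl
  ... | no ¬q-prime = contradiction q-prime ¬q-prime

  primeOrOne-¬prime : ∀ {q} → ¬ Prime q → primeOrOne q ≡ 1
  primeOrOne-¬prime {q} ¬q-prime with prime? q
  ... | yes q-prime = contradiction q-prime ¬q-prime
  ... | no _        = refl

  ∏primes : ℕ → ℕ → ℕ
  ∏primes a zero    = 1
  ∏primes a (suc m) = primeOrOne (suc (a + m)) * ∏primes a m

  ∏primes-split : ∀ a m → ∏primes 0 (a + m) ≡ ∏primes a m * ∏primes 0 a
  ∏primes-split a zero    = trans (cong (∏primes 0) (+-identityʳ a)) (sym (*-identityˡ _))
  ∏primes-split a (suc m) = begin
    ∏primes 0 (a + suc m)                                ≡⟨ cong (∏primes 0) (+-suc a m) ⟩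
    primeOrOne (suc (a + m)) * ∏primes 0 (a + m)         ≡⟨ cong (primeOrOne (suc (a + m)) *_) (∏primes-split a m) ⟩
    primeOrOne (suc (a + m)) * (∏primes a m * ∏primes 0 a) ≡⟨ *-assoc (primeOrOne (suc (a + m))) _ _ ⟨
    ∏primes a (suc m) * ∏primes 0 a                      ∎
    where open ≡-Reasoning

  prime∣∏primes : ∀ {p} → Prime p → ∀ a m → a < p → p ≤ a + m → p ∣ ∏primes a m
  prime∣∏primes {p} p-prime a zero a<p p≤a+0 = contradiction (subst (p ≤_) (+-identityʳ a) p≤a+0) (<⇒≱ a<p)
  prime∣∏primes {p} p-prime a (suc m) a<p p≤a+m+1 with m≤n⇒m<n∨m≡n (subst (p ≤_) (+-suc a m) p≤a+m+1)
  ... | inj₁ p<1+a+m = ∣n⇒∣m*n (primeOrOne (suc (a + m))) (prime∣∏primes p-prime a m a<p (s≤s⁻¹ p<1+a+m))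
  ... | inj₂ refl    = ∣m⇒∣m*n (∏primes a m) (∣-reflexive (sym (primeOrOne-prime p-prime)))

  prime∣∏primes⇒∈ : ∀ {q} → Prime q → ∀ a m → q ∣ ∏primes a m → a < q × q ≤ a + m
  prime∣∏primes⇒∈ q-prime a zero    q∣1 = contradiction (∣1⇒≡1 q∣1) (>⇒≢ (prime⇒>1 q-prime))
  prime∣∏primes⇒∈ {q} q-prime a (suc m) q∣∏ with euclidsLemma (primeOrOne (suc (a + m))) (∏primes a m) q-prime q∣∏
  ... | inj₂ q∣rest = let a<q , q≤a+m = prime∣∏primes⇒∈ q-prime a m q∣rest in
                      a<q , ≤-trans q≤a+m (+-monoʳ-≤ a (n≤1+n m))
  ... | inj₁ q∣head with prime? (suc (a + m))
  ...   | no _ = contradiction (∣1⇒≡1 q∣head) (>⇒≢ (prime⇒>1 q-prime))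
  ...   | yes r-prime with prime⇒irreducible r-prime q∣head
  ...     | inj₁ q≡1 = contradiction q≡1 (>⇒≢ (prime⇒>1 q-prime))
  ...     | inj₂ refl = s≤s (m≤m+n a m) , ≤-reflexive (sym (+-suc a m))

  ∏primes∣ : ∀ a m {N} → (∀ {p} → Prime p → a < p → p ≤ a + m → p ∣ N) → ∏primes a m ∣ N
  ∏primes∣ a zero    all∣N = 1∣ _
  ∏primes∣ a (suc m) {N} all∣N
    with ∏primes∣ a m (λ p-prime a<p p≤a+m → all∣N p-prime a<p (≤-trans p≤a+m (+-monoʳ-≤ a (n≤1+n m))))
  ... | divides w refl with prime? (suc (a + m))
  ...   | no _ = *-monoˡ-∣ (∏primes a m) (1∣ w)
  ...   | yes q-prime = *-monoˡ-∣ (∏primes a m) q∣w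
    where
    q = suc (a + m)
    q∣N : q ∣ w * ∏primes a m
    q∣N = all∣N q-prime (s≤s (m≤m+n a m)) (≤-reflexive (sym (+-suc a m)))
    q∣w : q ∣ w
    q∣w with euclidsLemma w (∏primes a m) q-prime q∣N
    ... | inj₁ q∣w    = q∣w
    ... | inj₂ q∣rest = contradiction (proj₂ (prime∣∏primes⇒∈ q-prime a m q∣rest)) (<⇒≱ ≤-refl)

  ∏primes≢0 : ∀ a m → NonZero (∏primes a m)
  ∏primes≢0 a zero    = _
  ∏primes≢0 a (suc m) = m*n≢0 _ _ {{primeOrOne≢0}} {{∏primes≢0 a m}}
    where
    primeOrOne≢0 : NonZero (primeOrOne (suc (a + m)))
    primeOrOne≢0 with prime? (suc (a + m))
    ... | yes _ = _
    ... | no  _ = _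

  data Halving : ℕ → Set where
    even : ∀ m → Halving (m + m)
    odd  : ∀ m → Halving (suc (m + m))

  halve : ∀ n → Halving n
  halve zero    = even 0
  halve (suc n) with halve n
  ... | even m = odd m
  ... | odd  m = subst Halving (cong suc (+-suc m m)) (even (suc m))

  even¬prime : ∀ m → ¬ Prime (suc (suc m) + suc (suc m))
  even¬prime m p-prime with prime⇒irreducible p-prime (divides {2} (suc (suc m)) double≡*2)
    where
    double≡*2 : ∀ {x} → x + x ≡ x * 2
    double≡*2 {x} = trans (cong (x +_) (sym (+-identityʳ x))) (*-comm 2 x)
  ... | inj₁ ()
  ... | inj₂ 2≡n = contradiction (sym 2≡n) (>⇒≢ (s≤s (s≤s (≤-trans (s≤s z≤n) (m≤n+m (suc (suc m)) m)))))

  -- Erdős: the primes in (M + 1 , 2M + 1] divide (2M + 1 choose M) ≤ 4ᴹ.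
  primorial≤4^ : ∀ n → ∏primes 0 n ≤ 4 ^ n
  primorial≤4^ n = go n (<-wellFounded n)
    where
    go : ∀ n → Acc _<_ n → ∏primes 0 n ≤ 4 ^ n
    go n (acc rec) with halve n
    ... | even zero          = ≤-refl
    ... | even (suc zero)    = s≤s (s≤s z≤n)
    ... | odd  zero          = s≤s z≤n
    ... | even (suc (suc m)) = begin
      primeOrOne (suc n′) * ∏primes 0 n′  ≡⟨ cong (_* ∏primes 0 n′) (primeOrOne-¬prime (even¬prime m)) ⟩
      1 * ∏primes 0 n′                   ≡⟨ *-identityˡ _ ⟩
      ∏primes 0 n′                       ≤⟨ go n′ (rec ≤-refl) ⟩
      4 ^ n′                             ≤⟨ m≤n*m (4 ^ n′) 4 ⟩
      4 * 4 ^ n′                         ∎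
      where
      open ≤-Reasoning
      n′ = suc (m + suc (suc m))
    ... | odd  (suc m)       = begin
      ∏primes 0 (suc M + M)                 ≡⟨ ∏primes-split (suc M) M ⟩
      ∏primes (suc M) M * ∏primes 0 (suc M) ≤⟨ *-mono-≤ middle≤4^M (go (suc M) (rec (s≤s (s≤s (m≤n+m (suc m) m))))) ⟩
      4 ^ M * 4 ^ suc M                     ≡⟨ *-comm (4 ^ M) _ ⟩
      4 ^ suc M * 4 ^ M                     ≡⟨ ^-distribˡ-+-* 4 (suc M) M ⟨
      4 ^ (suc M + M)                       ∎
      where
      open ≤-Reasoning
      M = suc m
      middle∣choose : ∏primes (suc M) M ∣ suc (M + M) choose M
      middle∣choose = ∏primes∣ (suc M) M λ {p} p-prime M+1<p p≤2M+1 →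
        subst (p ∣_) (cong (_choose M) (+-suc M M))
          (prime∣choose p-prime M (suc M) (<-trans (n<1+n M) M+1<p) M+1<p (subst (p ≤_) (sym (+-suc M M)) p≤2M+1))
      middle≤4^M : ∏primes (suc M) M ≤ 4 ^ M
      middle≤4^M = ≤-trans (∣⇒≤ {{>-nonZero (subst (1 ≤_) (cong (_choose M) (+-suc M M)) (1≤choose M (suc M)))}} middle∣choose)
                           ([2m+1]choose[m]≤4^m M)

  primeDivisor : ∀ K .{{_ : NonZero K}} → K ≢ 1 → ∃[ p ] Prime p × p ∣ K
  primeDivisor K K≢1 with factorise K
  ... | record { factors = [] ; isFactorisation = K≡1 } = contradiction K≡1 K≢1
  ... | record { factors = p ∷ ps ; isFactorisation = K≡p*ps ; factorsPrime = p-prime ∷ _ } =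
    p , p-prime , divides (product ps) (trans K≡p*ps (*-comm p (product ps)))

  factorOut : ∀ {p} → 1 < p → ∀ K .{{_ : NonZero K}} → ∃[ a ] ∃[ r ] K ≡ p ^ a * r × ¬ p ∣ r
  factorOut {p} 1<p K = go K (<-wellFounded K)
    where
    go : ∀ K .{{_ : NonZero K}} → Acc _<_ K → ∃[ a ] ∃[ r ] K ≡ p ^ a * r × ¬ p ∣ r
    go K (acc rec) with p ∣? K
    ... | no p∤K = 0 , K , sym (*-identityˡ K) , p∤K
    ... | yes (divides zero K≡0) = contradiction K≡0 (≢-nonZero⁻¹ K)
    ... | yes (divides q@(suc _) K≡q*p) with go q (rec (subst (q <_) (sym K≡q*p) (m<m*n q p 1<p)))
    ...   | a , r , q≡pᵃr , p∤r = suc a , r , K≡pᵃ⁺¹r , p∤r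
      where
      K≡pᵃ⁺¹r : K ≡ p * p ^ a * r
      K≡pᵃ⁺¹r = begin
        K               ≡⟨ K≡q*p ⟩
        q * p           ≡⟨ cong (_* p) q≡pᵃr ⟩
        p ^ a * r * p   ≡⟨ *-comm (p ^ a * r) p ⟩
        p * (p ^ a * r) ≡⟨ *-assoc p (p ^ a) r ⟨
        p * p ^ a * r   ∎
        where open ≡-Reasoning

  prime^∣*⇒∣ : ∀ {p r} → Prime p → ¬ p ∣ r → ∀ a w → p ^ a ∣ w * r → p ^ a ∣ w
  prime^∣*⇒∣ p-prime p∤r zero    w _ = 1∣ w
  prime^∣*⇒∣ {p} {r} p-prime p∤r (suc a) w pᵃ⁺¹∣wr
    with euclidsLemma w r p-prime (∣-trans (m∣m*n (p ^ a)) pᵃ⁺¹∣wr)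
  ... | inj₂ p∣r = contradiction p∣r p∤r
  ... | inj₁ (divides w′ refl) = subst (p * p ^ a ∣_) (*-comm p w′) (*-monoʳ-∣ p pᵃ∣w′)
    where
    instance _ = prime⇒nonZero p-prime
    pᵃ∣w′ : p ^ a ∣ w′
    pᵃ∣w′ = prime^∣*⇒∣ p-prime p∤r a w′
              (*-cancelˡ-∣ p (subst (p * p ^ a ∣_) (trans (cong (_* r) (*-comm w′ p)) (*-assoc p w′ r)) pᵃ⁺¹∣wr))

  -- Split K = pᵃ r with p ∤ r; then pᵃ ∣ Q and, by induction, r ∣ Q give pᵃ r ∣ Q.
  primePowers∣⇒∣ : ∀ {N Q} → (∀ {p a} → Prime p → p ^ a ≤ N → p ^ a ∣ Q) →
                   ∀ K .{{_ : NonZero K}} → K ≤ N → K ∣ Q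
  primePowers∣⇒∣ {N} {Q} pᵃ∣Q K = go K (<-wellFounded K)
    where
    go : ∀ K .{{_ : NonZero K}} → Acc _<_ K → K ≤ N → K ∣ Q
    go K (acc rec) K≤N with K ≟ 1
    ... | yes refl = 1∣ Q
    ... | no K≢1 with primeDivisor K K≢1
    ...   | p , p-prime , p∣K with factorOut (prime⇒>1 p-prime) K
    ...     | zero , r , refl , p∤r = contradiction (subst (p ∣_) (*-identityˡ r) p∣K) p∤r
    ...     | a@(suc a′) , r , refl , p∤r = glue (go r {{r≢0}} (rec r<K) (≤-trans (<⇒≤ r<K) K≤N))
      where
      p≢0 : NonZero p
      p≢0 = prime⇒nonZero p-prime
      instance
        r≢0 : NonZero r
        r≢0 = m*n≢0⇒n≢0 (p ^ a)
        pᵃ≢0 : NonZero (p ^ a)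
        pᵃ≢0 = m^n≢0 p a {{p≢0}}
      r<K : r < p ^ a * r
      r<K = subst (r <_) (*-comm r (p ^ a))
              (m<m*n r (p ^ a) (<-≤-trans (prime⇒>1 p-prime) (m≤m*n p (p ^ a′) {{m^n≢0 p a′ {{p≢0}}}})))
      glue : r ∣ Q → p ^ a * r ∣ Q
      glue (divides w refl) =
        *-monoˡ-∣ r (prime^∣*⇒∣ p-prime p∤r a w (pᵃ∣Q {a = a} p-prime (≤-trans (m≤m*n (p ^ a) r) K≤N)))

module Bertrand where

  open import Data.Nat
  open import Data.Nat.Properties
  open import Data.Nat.Divisibility
  open import Data.Nat.Primality using (Prime; prime⇒nonZero)
  open import Data.Nat.Tactic.RingSolver using (solve-∀)
  open import Data.Product using (∃-syntax; _×_; _,_; proj₂)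
  open import Relation.Nullary using (Dec; yes; no; contradiction)
  open import Relation.Binary.PropositionalEquality
  open import Function using (_∘_)
  open Binomial
  open Primes

  ^-distribʳ-* : ∀ m n k → (m * n) ^ k ≡ m ^ k * n ^ k
  ^-distribʳ-* m n zero    = refl
  ^-distribʳ-* m n (suc k) = trans (cong (m * n *_) (^-distribʳ-* m n k)) (regroup m n (m ^ k) (n ^ k))
    where
    regroup : ∀ m n x y → m * n * (x * y) ≡ m * x * (n * y)
    regroup = solve-∀

  ^-monoˡ-∣ : ∀ {m n} k → m ∣ n → m ^ k ∣ n ^ k
  ^-monoˡ-∣ zero    m∣n = ∣-refl
  ^-monoˡ-∣ (suc k) m∣n = *-pres-∣ m∣n (^-monoˡ-∣ k m∣n)

  ^-monoʳ-∣ : ∀ m {a b} → a ≤ b → m ^ a ∣ m ^ b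
  ^-monoʳ-∣ m {a} {b} a≤b = divides (m ^ (b ∸ a)) (begin
    m ^ b                 ≡⟨ cong (m ^_) (m+[n∸m]≡n a≤b) ⟨
    m ^ (a + (b ∸ a))     ≡⟨ ^-distribˡ-+-* m a (b ∸ a) ⟩
    m ^ a * m ^ (b ∸ a)   ≡⟨ *-comm (m ^ a) _ ⟩
    m ^ (b ∸ a) * m ^ a   ∎)
    where open ≡-Reasoning

  n!≤n^n : ∀ n → n ! ≤ n ^ n
  n!≤n^n zero    = ≤-refl
  n!≤n^n (suc n) = *-monoʳ-≤ (suc n) (≤-trans (n!≤n^n n) (^-monoˡ-≤ n (n≤1+n n)))

  exponent-bound : ∀ {p a N t} → 1 < p → p ^ a ≤ N → N < 2 ^ t → a ≤ t
  exponent-bound {p} {a} {N} {t} 1<p pᵃ≤N N<2ᵗ with a ≤? t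
  ... | yes a≤t = a≤t
  ... | no  a≰t =
    contradiction (≤-trans (^-monoʳ-≤ 2 (<⇒≤ (≰⇒> a≰t))) (≤-trans (^-monoˡ-≤ a 1<p) pᵃ≤N)) (<⇒≱ N<2ᵗ)

  -- For a ≥ 2 we have p ≤ √N ≤ B and a < t, so pᵃ divides (B !)ᵗ; for a = 1 it is a
  -- factor of the primorial.
  primePower∣ : ∀ {N B t} → N < 2 ^ t → (∀ i → i * i ≤ N → i ≤ B) →
                ∀ {p a} → Prime p → p ^ a ≤ N → p ^ a ∣ (B !) ^ t * ∏primes 0 N
  primePower∣ {N} {B} {t} N<2ᵗ √N≤B {p} {zero} p-prime _ = 1∣ _
  primePower∣ {N} {B} {t} N<2ᵗ √N≤B {p} {suc zero} p-prime p≤N =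
    ∣n⇒∣m*n ((B !) ^ t) (subst (_∣ ∏primes 0 N) (sym (*-identityʳ p))
      (prime∣∏primes p-prime 0 N (<-trans z<s (prime⇒>1 p-prime)) (subst (_≤ N) (*-identityʳ p) p≤N)))
  primePower∣ {N} {B} {t} N<2ᵗ √N≤B {p} {a@(suc (suc _))} p-prime pᵃ≤N =
    ∣m⇒∣m*n (∏primes 0 N) (∣-trans (^-monoˡ-∣ a (∣! (<⇒≤ (prime⇒>1 p-prime)) p≤B))
                                   (^-monoʳ-∣ (B !) {a} {t} (exponent-bound (prime⇒>1 p-prime) pᵃ≤N N<2ᵗ)))
    where
    p*p≤pᵃ : p * p ≤ p ^ a
    p*p≤pᵃ = subst (_≤ p ^ a) (cong (p *_) (*-identityʳ p)) (^-monoʳ-≤ p {{prime⇒nonZero p-prime}} {2} {a} (s≤s (s≤s z≤n)))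
    p≤B : p ≤ B
    p≤B = √N≤B p (≤-trans p*p≤pᵃ pᵃ≤N)

  -- Every i ≤ N = 4x + 1 divides Q = (B !)ᵗ · ∏primes 0 N, so 4²ˣ ≤ Q by the Leibniz
  -- triangle. Without primes in (x , N] the primorial factor is at most 4ˣ, forcing
  -- 4ˣ ≤ (B !)ᵗ.
  x<prime≤4x+1 : ∀ x t B → suc (4 * x) < 2 ^ t → (∀ i → i * i ≤ suc (4 * x) → i ≤ B) →
                 (B !) ^ t < 4 ^ x → ∃[ p ] Prime p × x < p × p ≤ suc (4 * x)
  x<prime≤4x+1 x t B N<2ᵗ √N≤B [B!]ᵗ<4ˣ = decide (∏primes x m ≟ 1)
    where
    m = suc (3 * x)
    N = suc (4 * x)
    x+m≡N : x + m ≡ N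
    x+m≡N = x+[3x+1]≡4x+1 x
      where
      x+[3x+1]≡4x+1 : ∀ x → x + suc (3 * x) ≡ suc (4 * x)
      x+[3x+1]≡4x+1 = solve-∀
    instance
      ∏≢0 : NonZero (∏primes x m)
      ∏≢0 = ∏primes≢0 x m
      Q≢0 : NonZero ((B !) ^ t * ∏primes 0 N)
      Q≢0 = m*n≢0 _ _ {{m^n≢0 (B !) t {{B !≢0}}}} {{∏primes≢0 0 N}}

    all∣Q : ∀ i → 1 ≤ i → i ≤ suc (x + x + (x + x)) → i ∣ (B !) ^ t * ∏primes 0 N
    all∣Q i 1≤i i≤ = primePowers∣⇒∣ (λ {p} {a} → primePower∣ {N} {B} {t} N<2ᵗ √N≤B {p} {a})
                                    i {{>-nonZero 1≤i}} (subst (i ≤_) (cong suc 4x≡) i≤)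
      where
      4x≡ : x + x + (x + x) ≡ 4 * x
      4x≡ = [x+x]+[x+x]≡4x x
        where
        [x+x]+[x+x]≡4x : ∀ x → x + x + (x + x) ≡ 4 * x
        [x+x]+[x+x]≡4x = solve-∀

    decide : Dec (∏primes x m ≡ 1) → ∃[ p ] Prime p × x < p × p ≤ N
    decide (no ∏≢1) with primeDivisor (∏primes x m) ∏≢1
    ... | q , q-prime , q∣∏ with prime∣∏primes⇒∈ q-prime x m q∣∏
    ...   | x<q , q≤x+m = q , q-prime , x<q , subst (q ≤_) x+m≡N q≤x+m
    decide (yes ∏≡1) = contradiction 4ˣ≤[B!]ᵗ (<⇒≱ [B!]ᵗ<4ˣ)
      where
      ∏primes≤4ˣ : ∏primes 0 N ≤ 4 ^ x
      ∏primes≤4ˣ = begin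
        ∏primes 0 N                ≡⟨ cong (∏primes 0) x+m≡N ⟨
        ∏primes 0 (x + m)          ≡⟨ ∏primes-split x m ⟩
        ∏primes x m * ∏primes 0 x  ≡⟨ cong (_* ∏primes 0 x) ∏≡1 ⟩
        1 * ∏primes 0 x            ≡⟨ *-identityˡ _ ⟩
        ∏primes 0 x                ≤⟨ primorial≤4^ x ⟩
        4 ^ x                      ∎
        where open ≤-Reasoning
      4ˣ≤[B!]ᵗ : 4 ^ x ≤ (B !) ^ t
      4ˣ≤[B!]ᵗ = *-cancelʳ-≤ (4 ^ x) ((B !) ^ t) (4 ^ x) {{m^n≢0 4 x}} (begin
        4 ^ x * 4 ^ x                ≡⟨ ^-distribˡ-+-* 4 x x ⟨
        4 ^ (x + x)                  ≤⟨ divisibleUpTo[2m+1]⇒4^m≤ {x + x} all∣Q ⟩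
        (B !) ^ t * ∏primes 0 N      ≤⟨ *-monoʳ-≤ ((B !) ^ t) ∏primes≤4ˣ ⟩
        (B !) ^ t * 4 ^ x            ∎)
        where open ≤-Reasoning

  2[j+2][2j+3]<2^j : ∀ j → 10 ≤ j → 2 * ((2 + j) * (3 + (j + j))) < 2 ^ j
  2[j+2][2j+3]<2^j j 10≤j = subst (λ j → f j < 2 ^ j) (proj₂ (m≤n⇒∃[o]m+o≡n 10≤j)) (from10 _)
    where
    f : ℕ → ℕ
    f j = 2 * ((2 + j) * (3 + (j + j)))
    f[j+1]+δ≡2f[j] : ∀ j′ → 2 * ((4 + j′) * (3 + (suc (suc j′) + suc (suc j′)))) + (4 * j′ * j′ + 14 * j′ + 4) ≡
                             2 * (2 * ((3 + j′) * (3 + (suc j′ + suc j′))))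
    f[j+1]+δ≡2f[j] = solve-∀
    from10 : ∀ k → f (10 + k) < 2 ^ (10 + k)
    from10 zero    = ≤ᵇ⇒≤ (suc (f 10)) (2 ^ 10) _
    from10 (suc k) = begin-strict
      f (11 + k)                                 ≤⟨ m≤m+n (f (11 + k)) _ ⟩
      f (11 + k) + (4 * j′ * j′ + 14 * j′ + 4)   ≡⟨ f[j+1]+δ≡2f[j] j′ ⟩
      2 * f (10 + k)                             <⟨ *-monoʳ-< 2 (from10 k) ⟩
      2 * 2 ^ (10 + k)                           ∎
      where
      open ≤-Reasoning
      j′ = 9 + k

  -- With x = 4ʲ, t = 2j + 3 and B = 2ʲ⁺² we have 2ᵗ = 8x > 4x + 1 and B² = 16x > 4x + 1,
  -- while (B !)ᵗ ≤ 2^((j + 2) B t) < 2^(2x) once 2 (j + 2)(2j + 3) < 2ʲ.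
  4^j<prime≤4^[j+1]+1 : ∀ j → 10 ≤ j → ∃[ p ] Prime p × 4 ^ j < p × p ≤ suc (4 * 4 ^ j)
  4^j<prime≤4^[j+1]+1 j 10≤j = x<prime≤4x+1 (4 ^ j) (3 + (j + j)) B N<2ᵗ √N≤B [B!]ᵗ<4ˣ
    where
    P = 2 ^ j
    x = 4 ^ j
    B = 2 ^ (2 + j)
    instance
      P≢0 : NonZero P
      P≢0 = m^n≢0 2 j
    x≡P*P : x ≡ P * P
    x≡P*P = ^-distribʳ-* 2 2 j
    1≤x : 1 ≤ x
    1≤x = m^n>0 4 j
    N<2ᵗ : suc (4 * x) < 2 ^ (3 + (j + j))
    N<2ᵗ = begin-strict
      suc (4 * x)
        <⟨ subst (_≤ 4 * x + 4 * x) (+-comm (4 * x) 2) (+-monoʳ-≤ (4 * x) (≤-trans (s≤s (s≤s z≤n)) (*-monoʳ-≤ 4 1≤x))) ⟩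
      4 * x + 4 * x             ≡⟨ 4y+4y≡8y x ⟩
      8 * x                     ≡⟨ cong (8 *_) (trans x≡P*P (sym (^-distribˡ-+-* 2 j j))) ⟩
      8 * 2 ^ (j + j)           ≡⟨ 8y≡2[2[2y]] (2 ^ (j + j)) ⟩
      2 ^ (3 + (j + j))         ∎
      where
      open ≤-Reasoning
      4y+4y≡8y : ∀ y → 4 * y + 4 * y ≡ 8 * y
      4y+4y≡8y = solve-∀
      8y≡2[2[2y]] : ∀ y → 8 * y ≡ 2 * (2 * (2 * y))
      8y≡2[2[2y]] = solve-∀
    √N≤B : ∀ i → i * i ≤ suc (4 * x) → i ≤ B
    √N≤B i i²≤N with i ≤? B
    ... | yes i≤B = i≤B
    ... | no  i≰B = contradiction i²≤N (<⇒≱ (begin-strict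
      suc (4 * x)           <⟨ s≤s (*-monoˡ-< x {{m^n≢0 4 j}} {4} {16} (s≤s (s≤s (s≤s (s≤s (s≤s z≤n)))))) ⟩
      suc (16 * x)          ≡⟨ cong (suc ∘ (16 *_)) x≡P*P ⟩
      suc (16 * (P * P))    ≡⟨ cong suc (16PP≡4P*4P P) ⟩
      suc (B * B)           ≤⟨ s≤s (≤-trans (*-monoʳ-≤ B (n≤1+n B)) (m≤n+m (B * suc B) B)) ⟩
      suc B * suc B         ≤⟨ *-mono-≤ (≰⇒> i≰B) (≰⇒> i≰B) ⟩
      i * i                 ∎))
      where
      open ≤-Reasoning
      16PP≡4P*4P : ∀ P → 16 * (P * P) ≡ 2 * (2 * P) * (2 * (2 * P))
      16PP≡4P*4P = solve-∀
    [B!]ᵗ<4ˣ : (B !) ^ (3 + (j + j)) < 4 ^ x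
    [B!]ᵗ<4ˣ = begin-strict
      (B !) ^ t                 ≤⟨ ^-monoˡ-≤ t (n!≤n^n B) ⟩
      (B ^ B) ^ t               ≡⟨ cong (_^ t) (^-*-assoc 2 (2 + j) B) ⟩
      (2 ^ ((2 + j) * B)) ^ t   ≡⟨ ^-*-assoc 2 ((2 + j) * B) t ⟩
      2 ^ ((2 + j) * B * t)     <⟨ ^-monoʳ-< 2 (s≤s (s≤s z≤n)) exponent< ⟩
      2 ^ (2 * x)               ≡⟨ ^-*-assoc 2 2 x ⟨
      4 ^ x                     ∎
      where
      open ≤-Reasoning
      t = 3 + (j + j)
      exponent< : (2 + j) * B * t < 2 * x
      exponent< = begin-strict
        (2 + j) * B * t                      ≡⟨ regroup₁ j t P ⟩
        2 * ((2 + j) * t) * (2 * P)          <⟨ *-monoˡ-< (2 * P) {{m*n≢0 2 P}} (2[j+2][2j+3]<2^j j 10≤j) ⟩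
        P * (2 * P)                          ≡⟨ regroup₂ P ⟩
        2 * (P * P)                          ≡⟨ cong (2 *_) x≡P*P ⟨
        2 * x                                ∎
        where
        regroup₁ : ∀ j t P → (2 + j) * (2 * (2 * P)) * t ≡ 2 * ((2 + j) * t) * (2 * P)
        regroup₁ = solve-∀
        regroup₂ : ∀ P → P * (2 * P) ≡ 2 * (P * P)
        regroup₂ = solve-∀

  power-between : ∀ b → 1 < b → ∀ n .{{_ : NonZero n}} → ∃[ j ] n ≤ b ^ j × b ^ j < b * n
  power-between b 1<b (suc zero)    = 0 , ≤-refl , subst (1 <_) (sym (*-identityʳ b)) 1<b
  power-between b 1<b (suc (suc n)) = step (power-between b 1<b (suc n))
    where
    instance
      b≢0 : NonZero b
      b≢0 = >-nonZero (<-trans z<s 1<b)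
    step : ∃[ j ] suc n ≤ b ^ j × b ^ j < b * suc n →
           ∃[ j ] suc (suc n) ≤ b ^ j × b ^ j < b * suc (suc n)
    step (j , n+1≤bʲ , bʲ<b[n+1]) with suc (suc n) ≤? b ^ j
    ... | yes n+2≤bʲ = j , n+2≤bʲ , <-trans bʲ<b[n+1] (*-monoʳ-< b (n<1+n _))
    ... | no  n+2≰bʲ = suc j , n+2≤b^[j+1] , subst (_< b * suc (suc n)) (cong (b *_) (sym bʲ≡n+1)) (*-monoʳ-< b (n<1+n _))
      where
      bʲ≡n+1 : b ^ j ≡ suc n
      bʲ≡n+1 = ≤-antisym (s≤s⁻¹ (≰⇒> n+2≰bʲ)) n+1≤bʲ
      n+2≤b^[j+1] : suc (suc n) ≤ b * b ^ j
      n+2≤b^[j+1] = begin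
        suc (suc n)       ≤⟨ s≤s (m≤n+m (suc n) n) ⟩
        suc n + suc n     ≡⟨ cong (suc n +_) (+-identityʳ (suc n)) ⟨
        2 * suc n         ≤⟨ *-monoˡ-≤ (suc n) 1<b ⟩
        b * suc n         ≡⟨ cong (b *_) bʲ≡n+1 ⟨
        b * b ^ j         ∎
        where open ≤-Reasoning

  -- Pattern-matching helpers instead of `with`: with-abstraction over a context that
  -- mentions 16 ^ 10 is prohibitively slow.
  n≤prime²≤400n : ∀ n → 16 ^ 10 < n → ∃[ p ] Prime p × n ≤ p * p × p * p ≤ 400 * n
  n≤prime²≤400n n 16¹⁰<n = near (power-between 16 (s≤s (s≤s z≤n)) n {{>-nonZero (≤-trans (s≤s z≤n) 16¹⁰<n)}})
    where
    near : ∃[ j ] n ≤ 16 ^ j × 16 ^ j < 16 * n → ∃[ p ] Prime p × n ≤ p * p × p * p ≤ 400 * n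
    near (j , n≤16ʲ , 16ʲ<16n) = square (4^j<prime≤4^[j+1]+1 j 10≤j)
      where
      10≤j : 10 ≤ j
      10≤j with 10 ≤? j
      ... | yes 10≤j = 10≤j
      ... | no  10≰j = contradiction (≤-trans n≤16ʲ (^-monoʳ-≤ 16 (≤-trans (n≤1+n j) (≰⇒> 10≰j)))) (<⇒≱ 16¹⁰<n)
      x = 4 ^ j
      16ʲ≡x*x : 16 ^ j ≡ x * x
      16ʲ≡x*x = ^-distribʳ-* 4 4 j
      square : ∃[ p ] Prime p × x < p × p ≤ suc (4 * x) → ∃[ p ] Prime p × n ≤ p * p × p * p ≤ 400 * n
      square (p , p-prime , x<p , p≤4x+1) = p , p-prime , n≤p² , p²≤400n
        where
        n≤p² : n ≤ p * p
        n≤p² = ≤-trans n≤16ʲ (≤-trans (≤-reflexive 16ʲ≡x*x) (*-mono-≤ (<⇒≤ x<p) (<⇒≤ x<p)))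
        p≤5x : p ≤ 5 * x
        p≤5x = ≤-trans p≤4x+1 (+-monoˡ-≤ (4 * x) (m^n>0 4 j))
        p²≤400n : p * p ≤ 400 * n
        p²≤400n = begin
          p * p              ≤⟨ *-mono-≤ p≤5x p≤5x ⟩
          5 * x * (5 * x)    ≡⟨ regroup x ⟩
          25 * (x * x)       ≡⟨ cong (25 *_) 16ʲ≡x*x ⟨
          25 * 16 ^ j        ≤⟨ *-monoʳ-≤ 25 (<⇒≤ 16ʲ<16n) ⟩
          25 * (16 * n)      ≡⟨ *-assoc 25 16 n ⟨
          400 * n            ∎
          where
          open ≤-Reasoning
          regroup : ∀ x → 5 * x * (5 * x) ≡ 25 * (x * x)
          regroup = solve-∀

open import Defs
open import Data.Nat using (ℕ; zero; suc; _+_; _*_; _^_; _≤_; z≤n; NonZero)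
open import Data.Nat.Primality using (Prime)
open import Data.Nat.Properties using (*-mono-≤; ≤-trans; ≮⇒≥; m≤m*n; *-suc; +-identityʳ; +-monoˡ-≤; module ≤-Reasoning)
open import Data.Fin using (Fin)
open import Data.Product using (Σ; ∃-syntax; _×_; _,_; curry)
open import Function using (_∘_; Equivalence)
open import Relation.Binary.PropositionalEquality using (cong)
open Visibility
open Counting
open LineColouring
open Bertrand

k[k+1]≤2k² : ∀ k → k * suc k ≤ 2 * (k * k)
k[k+1]≤2k² zero      = z≤n
k[k+1]≤2k² k@(suc _) = begin
  k * suc k      ≡⟨ *-suc k k ⟩
  k + k * k      ≤⟨ +-monoˡ-≤ (k * k) (m≤m*n k k) ⟩
  k * k + k * k  ≡⟨ cong (k * k +_) (+-identityʳ (k * k)) ⟨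
  2 * (k * k)    ∎
  where open ≤-Reasoning

theorem3p2 : Σ ℕ λ a → Σ ℕ λ b → Σ ℕ λ N →
    NonZero a × NonZero b ×
    ((n : ℕ) → N ≤ n → (k : ℕ) → IsChiMu (KnKn n) k →
      (n ≤ a * (k * k)) × (k * k ≤ b * n))
theorem3p2 = 2 , 400 , suc (16 ^ 10) , _ , _ , bounds
  where
  bounds : (n : ℕ) → suc (16 ^ 10) ≤ n → (k : ℕ) → IsChiMu (KnKn n) k →
           (n ≤ 2 * (k * k)) × (k * k ≤ 400 * n)
  bounds n 16¹⁰<n k (colouring , minimal) =
    lower (Equivalence.to mvColoring⇔rectangleFree colouring) , upper (n≤prime²≤400n n 16¹⁰<n)
    where
    lower : Σ (Fin n × Fin n → Fin k) (RectangleFree ∘ curry) → n ≤ 2 * (k * k)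
    lower (c , rf) = ≤-trans (rectangleFree⇒n≤k*[1+k] (curry c) rf) (k[k+1]≤2k² k)
    upper : ∃[ p ] Prime p × n ≤ p * p × p * p ≤ 400 * n → k * k ≤ 400 * n
    upper (p , p-prime , n≤p² , p²≤400n) = ≤-trans (*-mono-≤ k≤p k≤p) p²≤400n
      where
      k≤p : k ≤ p
      k≤p = ≮⇒≥ λ p<k → minimal p p<k
              (Equivalence.from mvColoring⇔rectangleFree (rectangleFreeColouring p-prime n≤p²))
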